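{- Let $(a_1,\ldots,a_m)$ and $(b_1,\ldots,b_m)$ be integer sequences, each consisting of pairwise distinct elements, and let $k\ge 0$. If they are order-isomorphic with $k$ mismatches, then the Hamming distance between the signatures $S(a_1,\ldots,a_m)$ and $S(b_1,\ldots,b_m)$ is at most $3k$.
   Context: Two integer sequences $(a_1,\ldots,a_m)$ and $(b_1,\ldots,b_m)$ are order-isomorphic with $k$ mismatches if one can select up to $k$ indices $1\le i_1<\ldots<i_k\le m$ such that $a_j\le a_{j'}$ iff $b_j\le b_{j'}$ for all $j,j'\notin\{i_1,\ldots,i_k\}$. For a sequence $(a_1,\ldots,a_m)$ of distinct integers, let $\mathrm{pred}(i)$ be the index $j$ such that $a_j$ is the predecessor of $a_i$ in $\{a_1,\ldots,a_m\}$ (the largest element smaller than $a_i$), or $0$ if $a_i$ is the smallest element. The signature is $S(a_1,\ldots,a_m)=(1-\mathrm{pred}(1),\ldots,m-\mathrm{pred}(m))$. The Hamming distance of two equal-length strings is the number of positions at which they differ. -}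

module Defs where

open import Data.Nat using (ℕ; zero; suc; _≤_)
open import Data.Product using (Σ; _×_)
open import Data.Integer as ℤ using (ℤ; +_; _-_)
open import Data.Fin using (Fin; toℕ)
open import Data.Fin.Subset using (Subset; _∉_; ∣_∣)
open import Data.List using (List; foldr; filter; length; allFin)
open import Data.Maybe using (Maybe; just; nothing)
open import Relation.Nullary using (¬?; yes; no)
open import Relation.Binary.PropositionalEquality using (_≡_)
open import Function.Bundles using (_⇔_)

-- Sequences of length m are functions Fin m → ℤ; position i : Fin m is the
-- 1-based index (toℕ i + 1) of the paper.

OrderIsoMismatch : {m : ℕ} → ℕ → (Fin m → ℤ) → (Fin m → ℤ) → Set
OrderIsoMismatch {m} k a b =
  Σ (Subset m) (λ M → (∣ M ∣ ≤ k) ×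
     ((j j′ : Fin m) → j ∉ M → j′ ∉ M → ((a j ℤ.≤ a j′) ⇔ (b j ℤ.≤ b j′))))

predCand : {m : ℕ} → (Fin m → ℤ) → Fin m → List (Fin m) → Maybe (Fin m)
predCand a i = foldr step nothing
  where
  step : _ → Maybe _ → Maybe _
  step j acc with a j ℤ.<? a i
  ... | no _ = acc
  ... | yes _ with acc
  ...   | nothing = just j
  ...   | just j₀ with a j₀ ℤ.<? a j
  ...     | yes _ = just j
  ...     | no _ = just j₀

pred : {m : ℕ} → (Fin m → ℤ) → Fin m → ℕ
pred {m} a i with predCand a i (allFin m)
... | nothing = 0
... | just j = suc (toℕ j)

signature : {m : ℕ} → (Fin m → ℤ) → Fin m → ℤ
signature a i = + suc (toℕ i) - + pred a i

hamming : {m : ℕ} → (Fin m → ℤ) → (Fin m → ℤ) → ℕ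
hamming {m} s t = length (filter (λ i → ¬? (s i ℤ.≟ t i)) (allFin m))

module Submission where

-- Off the mismatch set M the two sequences are ordered alike, so a position i
-- outside M whose predecessors in a and in b both lie outside M has the same
-- predecessor in both, hence the same signature entry. The signatures can thus
-- only differ on M, on pred_a⁻¹(M) and on pred_b⁻¹(M), and each of these has at
-- most ∣M∣ elements because pred is injective for a sequence of distinct values.

open import Defs
open import Data.Nat using (ℕ; suc; _≤_; _*_; _+_; z≤n; s≤s)
open import Data.Nat.Properties using (≤-reflexive; m≤n⇒m≤n+o; +-suc; +-mono-≤; *-monoʳ-≤; module ≤-Reasoning)
open import Data.Integer as ℤ using (ℤ)
import Data.Integer.Properties as ℤ
open import Data.Fin using (Fin; zero; suc; toℕ)
open import Data.Fin.Subset using (Subset; _∈_; _∉_; ∣_∣; inside; outside)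
open import Data.Fin.Subset.Properties using (_∈?_)
open import Data.Vec using ([]; _∷_)
import Data.Vec as Vec
open import Data.List using (List; []; _∷_; _++_; map; filter; length; allFin)
open import Data.List.Properties using (length-map; length-++)
open import Data.List.Relation.Unary.Any using (here; there)
import Data.List.Relation.Unary.All as All
open import Data.List.Membership.Propositional using () renaming (_∈_ to _∈ₗ_)
open import Data.List.Membership.Propositional.Properties
  using (∈-∃++; ∈-++⁻; ∈-map⁻; ∈-++⁺ˡ; ∈-++⁺ʳ; ∈-map⁺; ∈-filter⁺; ∈-filter⁻; ∈-allFin)
open import Data.List.Relation.Binary.Subset.Propositional using (_⊆_)
open import Data.List.Relation.Unary.Unique.Propositional using (Unique; _∷_)
import Data.List.Relation.Unary.Unique.Propositional.Properties as Unique
open import Data.Maybe using (Maybe; just; nothing; maybe)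
open import Data.Maybe.Relation.Unary.Any as Maybe using (just)
open import Data.Product using (_×_; _,_; proj₂)
open import Data.Sum using (_⊎_; inj₁; inj₂)
open import Data.Empty using (⊥-elim)
open import Function using (_∘_)
open import Function.Bundles using (_⇔_; Equivalence)
open import Function.Definitions using (Injective)
open import Relation.Binary using (tri<; tri≈; tri>)
open import Relation.Binary.PropositionalEquality using (_≡_; _≢_; refl; sym; trans; cong; subst; module ≡-Reasoning)
open import Relation.Nullary using (¬_; yes; no; ¬?)

Unique⊆⇒length≤ : {A : Set} {xs ys : List A} → Unique xs → xs ⊆ ys → length xs ≤ length ys
Unique⊆⇒length≤ {xs = []} _ _ = z≤n
Unique⊆⇒length≤ {xs = x ∷ xs} (x∉xs ∷ xs!) xs⊆ys
  with us , vs , refl ← ∈-∃++ (xs⊆ys (here refl)) = begin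
    suc (length xs)             ≤⟨ s≤s (Unique⊆⇒length≤ xs! xs⊆us++vs) ⟩
    suc (length (us ++ vs))     ≡⟨ cong suc (length-++ us) ⟩
    suc (length us + length vs) ≡⟨ sym (+-suc (length us) (length vs)) ⟩
    length us + suc (length vs) ≡⟨ sym (length-++ us) ⟩
    length (us ++ x ∷ vs)       ∎
  where
  open ≤-Reasoning
  xs⊆us++vs : xs ⊆ us ++ vs
  xs⊆us++vs y∈xs with ∈-++⁻ us (xs⊆ys (there y∈xs))
  ... | inj₁ y∈us         = ∈-++⁺ˡ y∈us
  ... | inj₂ (here refl)  = ⊥-elim (All.lookup x∉xs y∈xs refl)
  ... | inj₂ (there y∈vs) = ∈-++⁺ʳ us y∈vs

Injective⇒length≤ : {A B : Set} {f : A → B} {xs : List A} {ys : List B} →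
  Injective _≡_ _≡_ f → Unique xs → (∀ {x} → x ∈ₗ xs → f x ∈ₗ ys) → length xs ≤ length ys
Injective⇒length≤ {f = f} {xs} {ys} f-inj xs! f[xs]⊆ys = begin
  length xs         ≡⟨ sym (length-map f xs) ⟩
  length (map f xs) ≤⟨ Unique⊆⇒length≤ (Unique.map⁺ f-inj xs!) image⊆ys ⟩
  length ys         ∎
  where
  open ≤-Reasoning
  image⊆ys : map f xs ⊆ ys
  image⊆ys fx∈ with x , x∈xs , refl ← ∈-map⁻ f fx∈ = f[xs]⊆ys x∈xs

elements : ∀ {n} → Subset n → List (Fin n)
elements []            = []
elements (inside ∷ p)  = zero ∷ map suc (elements p)
elements (outside ∷ p) = map suc (elements p)

length-elements : ∀ {n} (p : Subset n) → length (elements p) ≡ ∣ p ∣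
length-elements []            = refl
length-elements (inside ∷ p)  = cong suc (trans (length-map suc (elements p)) (length-elements p))
length-elements (outside ∷ p) = trans (length-map suc (elements p)) (length-elements p)

∈-elements : ∀ {n} {p : Subset n} {x : Fin n} → x ∈ p → x ∈ₗ elements p
∈-elements {p = inside ∷ p}  Vec.here        = here refl
∈-elements {p = inside ∷ p}  (Vec.there x∈p) = there (∈-map⁺ suc (∈-elements x∈p))
∈-elements {p = outside ∷ p} (Vec.there x∈p) = ∈-map⁺ suc (∈-elements x∈p)

module _ {m : ℕ} (a : Fin m → ℤ) where

  PredecessorAmong : Fin m → List (Fin m) → Maybe (Fin m) → Set
  PredecessorAmong i l nothing  = ∀ {j} → j ∈ₗ l → a j ℤ.≮ a i
  PredecessorAmong i l (just j) =
    j ∈ₗ l × a j ℤ.< a i × (∀ {j′} → j′ ∈ₗ l → a j′ ℤ.< a i → a j′ ℤ.≤ a j)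

  predCand-correct : ∀ i l → PredecessorAmong i l (predCand a i l)
  predCand-correct i [] ()
  predCand-correct i (x ∷ l) with a x ℤ.<? a i | predCand a i l | predCand-correct i l
  ... | no ax≮ai | nothing | none = λ { (here refl) → ax≮ai ; (there j∈l) → none j∈l }
  ... | no ax≮ai | just j  | j∈l , aj<ai , max =
    there j∈l , aj<ai , λ { (here refl) ax<ai → ⊥-elim (ax≮ai ax<ai) ; (there j′∈l) → max j′∈l }
  ... | yes ax<ai | nothing | none =
    here refl , ax<ai , λ { (here refl) _ → ℤ.≤-refl ; (there j′∈l) aj′<ai → ⊥-elim (none j′∈l aj′<ai) }
  ... | yes ax<ai | just j | j∈l , aj<ai , max with a j ℤ.<? a x
  ...   | yes aj<ax = here refl , ax<ai ,
            λ { (here refl) _ → ℤ.≤-refl ; (there j′∈l) aj′<ai → ℤ.<⇒≤ (ℤ.≤-<-trans (max j′∈l aj′<ai) aj<ax) }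
  ...   | no aj≮ax = there j∈l , aj<ai ,
            λ { (here refl) _ → ℤ.≮⇒≥ aj≮ax ; (there j′∈l) → max j′∈l }

  predecessor : Fin m → Maybe (Fin m)
  predecessor i = predCand a i (allFin m)

  IsPredecessor : Fin m → Maybe (Fin m) → Set
  IsPredecessor i = PredecessorAmong i (allFin m)

  predecessor-correct : ∀ i → IsPredecessor i (predecessor i)
  predecessor-correct i = predCand-correct i (allFin m)

  pred≡predecessor : ∀ i → pred a i ≡ maybe (suc ∘ toℕ) 0 (predecessor i)
  pred≡predecessor i with predecessor i
  ... | nothing = refl
  ... | just j  = refl

  shared-predecessor⇒≮ : ∀ {i i′ x} → IsPredecessor i x → IsPredecessor i′ x → a i ℤ.≮ a i′
  shared-predecessor⇒≮ {x = nothing} _ none′ ai<ai′ = none′ (∈-allFin _) ai<ai′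
  shared-predecessor⇒≮ {x = just j} (_ , aj<ai , _) (_ , _ , max′) ai<ai′ =
    ℤ.<⇒≱ aj<ai (max′ (∈-allFin _) ai<ai′)

  predecessor≡⇒≮ : ∀ {i i′} → predecessor i ≡ predecessor i′ → a i ℤ.≮ a i′
  predecessor≡⇒≮ {i} {i′} eq = shared-predecessor⇒≮ (predecessor-correct i)
    (subst (IsPredecessor i′) (sym eq) (predecessor-correct i′))

  -- Injective also where the value is nothing: an injective a has a single minimum.
  predecessor-injective : Injective _≡_ _≡_ a → Injective _≡_ _≡_ predecessor
  predecessor-injective a-inj {i} {i′} eq with ℤ.<-cmp (a i) (a i′)
  ... | tri< ai<ai′ _ _ = ⊥-elim (predecessor≡⇒≮ eq ai<ai′)
  ... | tri≈ _ ai≡ai′ _ = a-inj ai≡ai′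
  ... | tri> _ _ ai′<ai = ⊥-elim (predecessor≡⇒≮ (sym eq) ai′<ai)

  predecessor⁻¹ : Subset m → List (Fin m)
  predecessor⁻¹ M = filter (λ i → Maybe.dec (_∈? M) (predecessor i)) (allFin m)

  length-predecessor⁻¹ : Injective _≡_ _≡_ a → ∀ M → length (predecessor⁻¹ M) ≤ ∣ M ∣
  length-predecessor⁻¹ a-inj M = begin
    length (predecessor⁻¹ M)       ≤⟨ Injective⇒length≤ (predecessor-injective a-inj)
                                        (Unique.filter⁺ _ (Unique.allFin⁺ m)) predecessor∈ ⟩
    length (map just (elements M)) ≡⟨ length-map just (elements M) ⟩
    length (elements M)            ≡⟨ length-elements M ⟩
    ∣ M ∣                          ∎
    where
    open ≤-Reasoning
    just∈ : ∀ {x} → Maybe.Any (_∈ M) x → x ∈ₗ map just (elements M)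
    just∈ (just j∈M) = ∈-map⁺ just (∈-elements j∈M)
    predecessor∈ : ∀ {i} → i ∈ₗ predecessor⁻¹ M → predecessor i ∈ₗ map just (elements M)
    predecessor∈ i∈ = just∈ (proj₂ (∈-filter⁻ _ {xs = allFin m} i∈))

signature-cong : ∀ {m} {a b : Fin m → ℤ} {i} →
  predecessor a i ≡ predecessor b i → signature a i ≡ signature b i
signature-cong {a = a} {b} {i} eq = cong (λ p → ℤ.+ suc (toℕ i) ℤ.- ℤ.+ p) (begin
  pred a i                              ≡⟨ pred≡predecessor a i ⟩
  maybe (suc ∘ toℕ) 0 (predecessor a i) ≡⟨ cong (maybe (suc ∘ toℕ) 0) eq ⟩
  maybe (suc ∘ toℕ) 0 (predecessor b i) ≡⟨ sym (pred≡predecessor b i) ⟩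
  pred b i                              ∎)
  where open ≡-Reasoning

module _ {m : ℕ} {a b : Fin m → ℤ} (M : Subset m)
  (iso : (j j′ : Fin m) → j ∉ M → j′ ∉ M → (a j ℤ.≤ a j′) ⇔ (b j ℤ.≤ b j′)) where

  <-preserved : ∀ {i j} → i ∉ M → j ∉ M → a j ℤ.< a i → b j ℤ.< b i
  <-preserved {i} {j} i∉M j∉M aj<ai = ℤ.≰⇒> (ℤ.<⇒≱ aj<ai ∘ Equivalence.from (iso i j i∉M j∉M))

  <-reflected : ∀ {i j} → i ∉ M → j ∉ M → b j ℤ.< b i → a j ℤ.< a i
  <-reflected {i} {j} i∉M j∉M bj<bi = ℤ.≰⇒> (ℤ.<⇒≱ bj<bi ∘ Equivalence.to (iso i j i∉M j∉M))

  predecessors-agree : Injective _≡_ _≡_ a → ∀ {i x y} → i ∉ M →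
    IsPredecessor a i x → IsPredecessor b i y →
    ¬ Maybe.Any (_∈ M) x → ¬ Maybe.Any (_∈ M) y → x ≡ y
  predecessors-agree _ {x = nothing} {nothing} _ _ _ _ _ = refl
  predecessors-agree _ {x = nothing} {just j′} i∉M noneᵃ (_ , bj′<bi , _) _ j′∉M =
    ⊥-elim (noneᵃ (∈-allFin j′) (<-reflected i∉M (j′∉M ∘ just) bj′<bi))
  predecessors-agree _ {x = just j} {nothing} i∉M (_ , aj<ai , _) noneᵇ j∉M _ =
    ⊥-elim (noneᵇ (∈-allFin j) (<-preserved i∉M (j∉M ∘ just) aj<ai))
  predecessors-agree a-inj {x = just j} {just j′} i∉M
    (_ , aj<ai , maxᵃ) (_ , bj′<bi , maxᵇ) j∉M j′∉M = cong just (a-inj (ℤ.≤-antisym aj≤aj′ aj′≤aj))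
    where
    aj′≤aj = maxᵃ (∈-allFin j′) (<-reflected i∉M (j′∉M ∘ just) bj′<bi)
    bj≤bj′ = maxᵇ (∈-allFin j) (<-preserved i∉M (j∉M ∘ just) aj<ai)
    aj≤aj′ = Equivalence.from (iso j j′ (j∉M ∘ just) (j′∉M ∘ just)) bj≤bj′

  signature-mismatch : Injective _≡_ _≡_ a → ∀ i → signature a i ≢ signature b i →
    i ∈ M ⊎ Maybe.Any (_∈ M) (predecessor a i) ⊎ Maybe.Any (_∈ M) (predecessor b i)
  signature-mismatch a-inj i sa≢sb
    with i ∈? M | Maybe.dec (_∈? M) (predecessor a i) | Maybe.dec (_∈? M) (predecessor b i)
  ... | yes i∈M | _        | _        = inj₁ i∈M
  ... | no _    | yes pa∈M | _        = inj₂ (inj₁ pa∈M)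
  ... | no _    | no _     | yes pb∈M = inj₂ (inj₂ pb∈M)
  ... | no i∉M  | no pa∉M  | no pb∉M  = ⊥-elim (sa≢sb (signature-cong {a = a} {b}
    (predecessors-agree a-inj i∉M (predecessor-correct a i) (predecessor-correct b i) pa∉M pb∉M)))

  hamming≤3∣M∣ : Injective _≡_ _≡_ a → Injective _≡_ _≡_ b →
    hamming (signature a) (signature b) ≤ 3 * ∣ M ∣
  hamming≤3∣M∣ a-inj b-inj = begin
    length mismatches
      ≤⟨ Unique⊆⇒length≤ (Unique.filter⁺ _ (Unique.allFin⁺ m)) mismatches⊆ ⟩
    length (elements M ++ predecessor⁻¹ a M ++ predecessor⁻¹ b M)
      ≡⟨ length-++ (elements M) ⟩
    length (elements M) + length (predecessor⁻¹ a M ++ predecessor⁻¹ b M)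
      ≡⟨ cong (length (elements M) +_) (length-++ (predecessor⁻¹ a M)) ⟩
    length (elements M) + (length (predecessor⁻¹ a M) + length (predecessor⁻¹ b M))
      ≤⟨ +-mono-≤ (≤-reflexive (length-elements M))
           (+-mono-≤ (length-predecessor⁻¹ a a-inj M) (m≤n⇒m≤n+o 0 (length-predecessor⁻¹ b b-inj M))) ⟩
    3 * ∣ M ∣
      ∎
    where
    open ≤-Reasoning
    mismatch? = λ i → ¬? (signature a i ℤ.≟ signature b i)
    mismatches = filter mismatch? (allFin m)
    mismatches⊆ : mismatches ⊆ elements M ++ predecessor⁻¹ a M ++ predecessor⁻¹ b M
    mismatches⊆ {i} i∈ with signature-mismatch a-inj i (proj₂ (∈-filter⁻ mismatch? {xs = allFin m} i∈))
    ... | inj₁ i∈M         = ∈-++⁺ˡ (∈-elements i∈M)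
    ... | inj₂ (inj₁ pa∈M) = ∈-++⁺ʳ (elements M) (∈-++⁺ˡ (∈-filter⁺ _ (∈-allFin i) pa∈M))
    ... | inj₂ (inj₂ pb∈M) = ∈-++⁺ʳ (elements M) (∈-++⁺ʳ (predecessor⁻¹ a M) (∈-filter⁺ _ (∈-allFin i) pb∈M))

lemma3 : (m k : ℕ) (a b : Fin m → ℤ)
    → Injective _≡_ _≡_ a → Injective _≡_ _≡_ b
    → OrderIsoMismatch k a b
    → hamming (signature a) (signature b) ≤ 3 * k
lemma3 m k a b a-inj b-inj (M , ∣M∣≤k , iso) = begin
  hamming (signature a) (signature b) ≤⟨ hamming≤3∣M∣ M iso a-inj b-inj ⟩
  3 * ∣ M ∣                           ≤⟨ *-monoʳ-≤ 3 ∣M∣≤k ⟩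
  3 * k                               ∎
  where open ≤-Reasoning
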